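{- (Sequence-relevance downward closure.) Let $\mathcal{PD}$ be a finite database of wLAS-sequences and let $T_1, T_2$ be trajectory-patterns with $T_1 \subseteq T_2$. Then $$MSR(T_2) \le MSR(T_1),$$ where for a trajectory-pattern $T$, $MSR(T) = \sum_{\alpha \in \mathcal{PD},\ T \precsim \alpha} \mathcal{R}(\alpha)$.
   Context: Fix a finite set of cells $\mathcal{P}=\{p_1,\dots,p_n\}$ and a finite set $I$ of activities. A wLAS (weighted location-activity-set) is a pair $\alpha_t=(AL_t,AX_t)$ where $AL_t=\{p_{i_1}:w_{i_1},\dots,p_{i_k}:w_{i_k}\}$ is a nonempty set of distinct cells each carrying a weight $w(p_{i_s},\alpha_t)\in(0,1]$, and $AX_t\subseteq I$ is a nonempty activity set. Write $\alpha_t.loc=\{p_{i_1},\dots,p_{i_k}\}$ and $\alpha_t.act=AX_t$. A wLAS-sequence is a finite sequence $\alpha=\langle\alpha_1,\dots,\alpha_m\rangle$ of wLAS; a database $\mathcal{PD}$ is a finite collection of wLAS-sequences. A trajectory-pattern is a sequence $T=\langle (P_1,X_1),\dots,(P_n,X_n)\rangle$ with each $P_i\subseteq\mathcal{P}$ a nonempty set of cells and $X_i\subseteq I$ a nonempty set of activities. For patterns $T_1=\langle (P_i,X_i)\rangle_{i=1}^{n}$ and $T_2=\langle (P'_j,X'_j)\rangle_{j=1}^{q}$, $T_1\subseteq T_2$ means $n\le q$ and there are indices $1\le j_1<\dots<j_n\le q$ with $P_i\subseteq P'_{j_i}$ and $X_i\subseteq X'_{j_i}$ for all $i$. $T$ matches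 $\alpha=\langle\alpha_1,\dots,\alpha_m\rangle$, written $T\precsim\alpha$, if there exist indices $1\le j_1<\dots<j_n\le m$ with $P_i\subseteq\alpha_{j_i}.loc$ and $X_i\subseteq\alpha_{j_i}.act$ for all $i$ (such an index tuple is called a match of $T$ in $\alpha$). Relevance: for a cell $p$ and activity $a$, $\mathcal{R}((p,a),\alpha_t)=w(p,\alpha_t)$ if $p\in\alpha_t.loc$ and $a\in\alpha_t.act$, and $0$ otherwise; for a term $(L,X)$, $\mathcal{R}((L,X),\alpha_t)=\min_{a\in X}\sum_{p\in L}\mathcal{R}((p,a),\alpha_t)$. For a pattern $T$ and a wLAS-sequence $\alpha$, $\mathcal{R}_{\max}(T,\alpha)$ is the maximum of $\sum_{i=1}^n\mathcal{R}((P_i,X_i),\alpha_{j_i})$ over all matches $(j_1,\dots,j_n)$ of $T$ in $\alpha$ (and $0$ if $T\not\precsim\alpha$). The r-pattern of $\alpha=\langle\alpha_1,\dots,\alpha_m\rangle$ is $\langle(\alpha_1.loc,\alpha_1.act),\dots,(\alpha_m.loc,\alpha_m.act)\rangle$, and the sequence-relevance of $\alpha$ is $\mathcal{R}(\alpha)=\mathcal{R}_{\max}(\text{r-pattern of }\alpha,\alpha)$.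
   Formalization: The cell weights $w(p,\alpha_t)$ of every wLAS are rational numbers in (0,1]. -}

module Defs where

open import Data.Nat using (ℕ)
open import Data.Fin using (Fin)
open import Data.Fin.Subset using (Subset; _∈_; _⊆_; Nonempty)
open import Data.Fin.Subset.Properties using (_∈?_; _⊆?_)
open import Data.List using (List; []; _∷_; _++_; map; foldr; filter; allFin)
open import Data.List.Relation.Binary.Sublist.Heterogeneous using (Sublist)
open import Data.List.Relation.Binary.Sublist.Heterogeneous.Properties using (sublist?)
open import Data.Rational using (ℚ; 0ℚ; 1ℚ; _+_; _⊓_; _⊔_; _<_; _≤_)
open import Data.Product using (_×_; _,_; proj₁; proj₂)
open import Relation.Nullary using (Dec; yes; no; ¬_)
open import Relation.Nullary.Decidable using (_×-dec_)

-- A wLAS α_t = (AL_t, AX_t).  The weight function is only relevant on the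
-- cells of `loc`; there it takes values in (0,1].
record wLAS (n k : ℕ) : Set where
  field
    loc      : Subset n
    act      : Subset k
    weight   : Fin n → ℚ
    loc-ne   : Nonempty loc
    act-ne   : Nonempty act
    weight-pos : ∀ p → p ∈ loc → 0ℚ < weight p
    weight-le1 : ∀ p → p ∈ loc → weight p ≤ 1ℚ
open wLAS public

wLASSeq : ℕ → ℕ → Set
wLASSeq n k = List (wLAS n k)

Database : ℕ → ℕ → Set
Database n k = List (wLASSeq n k)

record Term (n k : ℕ) : Set where
  constructor term
  field
    cells   : Subset n
    acts    : Subset k
    cells-ne : Nonempty cells
    acts-ne  : Nonempty acts
open Term public

Pattern : ℕ → ℕ → Set
Pattern n k = List (Term n k)

_⊑ₜ_ : ∀ {n k} → Term n k → Term n k → Set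
t ⊑ₜ t' = (cells t ⊆ cells t') × (acts t ⊆ acts t')

_⊆ₚ_ : ∀ {n k} → Pattern n k → Pattern n k → Set
_⊆ₚ_ = Sublist _⊑ₜ_

Fits : ∀ {n k} → Term n k → wLAS n k → Set
Fits t a = (cells t ⊆ loc a) × (acts t ⊆ act a)

fits? : ∀ {n k} (t : Term n k) (a : wLAS n k) → Dec (Fits t a)
fits? t a = (cells t ⊆? loc a) ×-dec (acts t ⊆? act a)

_≾_ : ∀ {n k} → Pattern n k → wLASSeq n k → Set
T ≾ α = Sublist Fits T α

_≾?_ : ∀ {n k} (T : Pattern n k) (α : wLASSeq n k) → Dec (T ≾ α)
T ≾? α = sublist? fits? T α

elems : ∀ {m} → Subset m → List (Fin m)
elems s = filter (_∈? s) (allFin _)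

sumℚ : List ℚ → ℚ
sumℚ = foldr _+_ 0ℚ

-- minimum of a list (only used on nonempty lists; 0 on the empty list)
minℚ : List ℚ → ℚ
minℚ []       = 0ℚ
minℚ (x ∷ xs) = foldr _⊓_ x xs

maxℚ : List ℚ → ℚ
maxℚ []       = 0ℚ
maxℚ (x ∷ xs) = foldr _⊔_ x xs

Rpa : ∀ {n k} → Fin n → Fin k → wLAS n k → ℚ
Rpa p x a with p ∈? loc a | x ∈? act a
... | yes _ | yes _ = weight a p
... | _     | _     = 0ℚ

Rterm : ∀ {n k} → Subset n → Subset k → wLAS n k → ℚ
Rterm L X a = minℚ (map (λ x → sumℚ (map (λ p → Rpa p x a) (elems L))) (elems X))

-- All matches of T in α, each given as the list of aligned pairs
-- (term (P_i,X_i), wLAS α_{j_i}) for an index tuple j_1 < … < j_n.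
matches : ∀ {n k} → List (Subset n × Subset k) → wLASSeq n k
        → List (List ((Subset n × Subset k) × wLAS n k))
matches []       α       = [] ∷ []
matches (t ∷ T) []       = []
matches (t ∷ T) (a ∷ α) with proj₁ t ⊆? loc a | proj₂ t ⊆? act a
... | yes _ | yes _ = map ((t , a) ∷_) (matches T α) ++ matches (t ∷ T) α
... | _     | _     = matches (t ∷ T) α

Rmax : ∀ {n k} → List (Subset n × Subset k) → wLASSeq n k → ℚ
Rmax T α = maxℚ (map (λ m → sumℚ (map (λ { ((L , X) , a) → Rterm L X a }) m))
                     (matches T α))

rPattern : ∀ {n k} → wLASSeq n k → List (Subset n × Subset k)
rPattern = map (λ a → loc a , act a)

seqRel : ∀ {n k} → wLASSeq n k → ℚ
seqRel α = Rmax (rPattern α) α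

MSR : ∀ {n k} → Database n k → Pattern n k → ℚ
MSR PD T = sumℚ (map seqRel (filter (T ≾?_) PD))

{-# OPTIONS --safe #-}
-- A database sequence that matches T₂ also matches every subpattern T₁ ⊆ T₂,
-- so MSR(T₁) sums over a superset of the sequences summed in MSR(T₂).  Since
-- weights are positive, every sequence-relevance is nonnegative, and adding
-- the extra summands can only increase the total.
module Submission where

open import Defs
open import Data.Nat using (ℕ)
open import Data.Fin using (Fin)
open import Data.Fin.Subset.Properties using (_∈?_)
open import Data.List using (List; []; _∷_; map; filter)
open import Data.List.Properties using (foldr-preservesᵇ; foldr-preservesʳ)
open import Data.List.Relation.Unary.All using (All; []; _∷_; universal)
open import Data.List.Relation.Unary.All.Properties using (map⁺)
import Data.List.Relation.Binary.Sublist.Heterogeneous.Properties as Sublist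
open import Data.Product using (_,_)
open import Data.Rational using (ℚ; 0ℚ; _+_; _⊔_; _≤_)
open import Data.Rational.Properties
  using (≤-refl; <⇒≤; +-mono-≤; +-monoʳ-≤; +-identityˡ; ⊓-glb; p≤q⇒p≤r⊔q; module ≤-Reasoning)
open import Relation.Binary.PropositionalEquality using (sym)
open import Relation.Nullary using (yes; no; contradiction)
open import Relation.Unary using (Pred; Decidable; _⊆_)

private
  variable
    A : Set
    n k : ℕ

all-0≤-map : {f : A → ℚ} → (∀ x → 0ℚ ≤ f x) → ∀ xs → All (0ℚ ≤_) (map f xs)
all-0≤-map f≥0 xs = map⁺ (universal f≥0 xs)

0≤sumℚ : {xs : List ℚ} → All (0ℚ ≤_) xs → 0ℚ ≤ sumℚ xs
0≤sumℚ = foldr-preservesᵇ (+-mono-≤ {0ℚ} {_} {0ℚ}) ≤-refl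

0≤minℚ : {xs : List ℚ} → All (0ℚ ≤_) xs → 0ℚ ≤ minℚ xs
0≤minℚ []           = ≤-refl
0≤minℚ (x≥0 ∷ xs≥0) = foldr-preservesᵇ ⊓-glb x≥0 xs≥0

0≤maxℚ : {xs : List ℚ} → All (0ℚ ≤_) xs → 0ℚ ≤ maxℚ xs
0≤maxℚ []                 = ≤-refl
0≤maxℚ {_ ∷ xs} (x≥0 ∷ _) =
  foldr-preservesʳ {P = 0ℚ ≤_} {f = _⊔_} (λ y → p≤q⇒p≤r⊔q y) x≥0 xs

0≤Rpa : (p : Fin n) (x : Fin k) (a : wLAS n k) → 0ℚ ≤ Rpa p x a
0≤Rpa p x a with p ∈? loc a | x ∈? act a
... | yes p∈loc | yes _ = <⇒≤ (weight-pos a p p∈loc)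
... | yes _     | no _  = ≤-refl
... | no _      | _     = ≤-refl

0≤Rterm : ∀ L X (a : wLAS n k) → 0ℚ ≤ Rterm L X a
0≤Rterm L X a = 0≤minℚ (all-0≤-map sum≥0 (elems X))
  where
  sum≥0 : ∀ x → 0ℚ ≤ sumℚ (map (λ p → Rpa p x a) (elems L))
  sum≥0 x = 0≤sumℚ (all-0≤-map (λ p → 0≤Rpa p x a) (elems L))

0≤Rmax : ∀ T (α : wLASSeq n k) → 0ℚ ≤ Rmax T α
0≤Rmax T α =
  0≤maxℚ (all-0≤-map (λ m → 0≤sumℚ
    (all-0≤-map (λ ((L , X) , a) → 0≤Rterm L X a) m)) (matches T α))

0≤seqRel : (α : wLASSeq n k) → 0ℚ ≤ seqRel α
0≤seqRel α = 0≤Rmax (rPattern α) α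

⊑ₜ-Fits-trans : {t t′ : Term n k} {a : wLAS n k} → t ⊑ₜ t′ → Fits t′ a → Fits t a
⊑ₜ-Fits-trans (P⊆P′ , X⊆X′) (P′⊆loc , X′⊆act) =
  (λ p∈P → P′⊆loc (P⊆P′ p∈P)) , (λ x∈X → X′⊆act (X⊆X′ x∈X))

⊆ₚ-≾-trans : {T₁ T₂ : Pattern n k} {α : wLASSeq n k} → T₁ ⊆ₚ T₂ → T₂ ≾ α → T₁ ≾ α
-- The terms cannot be inferred, since _⊑ₜ_ and Fits only mention their fields.
⊆ₚ-≾-trans = Sublist.trans (λ {t} {t′} {a} → ⊑ₜ-Fits-trans {t = t} {t′ = t′} {a = a})

sumℚ-filter-mono : ∀ {p q} {P : Pred A p} {Q : Pred A q} (P? : Decidable P) (Q? : Decidable Q) →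
                   P ⊆ Q → {f : A → ℚ} → (∀ x → 0ℚ ≤ f x) →
                   ∀ xs → sumℚ (map f (filter P? xs)) ≤ sumℚ (map f (filter Q? xs))
sumℚ-filter-mono P? Q? P⊆Q f≥0 [] = ≤-refl
sumℚ-filter-mono P? Q? P⊆Q {f} f≥0 (x ∷ xs) with P? x | Q? x
... | yes Px | no ¬Qx = contradiction (P⊆Q Px) ¬Qx
... | yes _  | yes _  = +-monoʳ-≤ (f x) (sumℚ-filter-mono P? Q? P⊆Q f≥0 xs)
... | no _   | no _   = sumℚ-filter-mono P? Q? P⊆Q f≥0 xs
... | no _   | yes _  = begin
  sumℚ (map f (filter P? xs))       ≡⟨ sym (+-identityˡ _) ⟩
  0ℚ + sumℚ (map f (filter P? xs))  ≤⟨ +-mono-≤ (f≥0 x) (sumℚ-filter-mono P? Q? P⊆Q f≥0 xs) ⟩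
  f x + sumℚ (map f (filter Q? xs)) ∎
  where open ≤-Reasoning

theorem1 : (n k : ℕ) (PD : Database n k) (T₁ T₂ : Pattern n k) →
           T₁ ⊆ₚ T₂ → MSR PD T₂ ≤ MSR PD T₁
theorem1 n k PD T₁ T₂ T₁⊆T₂ =
  sumℚ-filter-mono (T₂ ≾?_) (T₁ ≾?_) (⊆ₚ-≾-trans T₁⊆T₂) 0≤seqRel PD
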